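{- Let $G\in\mathscr{G}_{a,b}$ be a graph containing a cycle and having at least one pendant vertex, with base $\widetilde G$. (i) If $u\in V_{\widetilde G}$, then $d_G(u)\in\{d_{\widetilde G}(u),\,a+b-1\}$; if $u\notin V_{\widetilde G}$, then $d_G(u)=1$. (ii) If $u\in V_{\widetilde G}$ is an attached vertex, then $b\le -1$, $d_G(u)=a+b-1>d_{\widetilde G}(u)$, and $\sum_{v\in N_{\widetilde G}(u)}d_G(v)=-ab-b^2+2b+d_{\widetilde G}(u)$.
   Context: All graphs are finite, simple, connected, with at least one edge; $d_G(v)$ is the degree of $v$ and $N_G(v)$ its neighbourhood. A pendant vertex is a vertex of degree $1$. For integers $a,b$, $\mathscr{G}_{a,b}$ denotes the set of such graphs $G$ for which $(a,b)$ is the unique pair of integers such that $\sum_{u\in N_G(v)}d_G(u)=a\,d_G(v)+b-d_G(v)^2$ for every $v\in V_G$. The base $\widetilde G$ of $G$ is the subgraph obtained by repeatedly deleting pendant vertices until none remain. A vertex $u\in V_{\widetilde G}$ is called an attached vertex if it is adjacent in $G$ to some pendant vertex of $G$. -}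

module Defs where

open import Data.Nat using (ℕ; zero; suc) renaming (_+_ to _ℕ+_)
open import Data.Bool using (Bool; true; false; if_then_else_; _∧_; not)
open import Data.Fin using (Fin; zero; suc; inject₁; fromℕ)
open import Data.Fin.Properties using (_≟_)
open import Data.List using (List; []; _∷_; map; allFin)
open import Data.Nat.ListAction using (sum)
open import Data.Integer using (ℤ; +_; _+_; _*_; _-_)
open import Data.Product using (Σ; _×_; ∃)
open import Relation.Binary.PropositionalEquality using (_≡_; _≢_)
open import Relation.Nullary.Decidable using (⌊_⌋)
open import Function.Definitions using (Injective)

record Graph (n : ℕ) : Set where
  field
    adj    : Fin n → Fin n → Bool
    sym    : ∀ u v → adj u v ≡ adj v u
    irrefl : ∀ v → adj v v ≡ false
open Graph public

sumOver : ∀ {n} → (Fin n → Bool) → (Fin n → ℕ) → ℕ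
sumOver {n} p f = sum (map (λ u → if p u then f u else 0) (allFin n))

allV : ∀ {n} → Fin n → Bool
allV _ = true

degIn : ∀ {n} → Graph n → (Fin n → Bool) → Fin n → ℕ
degIn G S v = sumOver (λ u → S u ∧ adj G v u) (λ _ → 1)

deg : ∀ {n} → Graph n → Fin n → ℕ
deg G = degIn G allV

nbrDegSumIn : ∀ {n} → Graph n → (Fin n → Bool) → Fin n → ℕ
nbrDegSumIn G S v = sumOver (λ u → S u ∧ adj G v u) (deg G)

nbrDegSum : ∀ {n} → Graph n → Fin n → ℕ
nbrDegSum G = nbrDegSumIn G allV

Satisfies : ∀ {n} → Graph n → ℤ → ℤ → Set
Satisfies G a b = ∀ v →
  + (nbrDegSum G v) ≡ a * + (deg G v) + b - + (deg G v) * + (deg G v)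

InClass : ∀ {n} → Graph n → ℤ → ℤ → Set
InClass G a b = Satisfies G a b × (∀ a' b' → Satisfies G a' b' → a' ≡ a × b' ≡ b)

data Reach {n} (G : Graph n) : Fin n → Fin n → Set where
  here : ∀ {u} → Reach G u u
  step : ∀ {u v w} → adj G u v ≡ true → Reach G v w → Reach G u w

Connected : ∀ {n} → Graph n → Set
Connected G = ∀ u v → Reach G u v

HasEdge : ∀ {n} → Graph n → Set
HasEdge G = Σ _ λ u → Σ _ λ v → adj G u v ≡ true

HasCycle : ∀ {n} → Graph n → Set
HasCycle {n} G =
  Σ ℕ λ k → Σ (Fin (3 ℕ+ k) → Fin n) λ c →
    Injective _≡_ _≡_ c
    × (∀ (i : Fin (2 ℕ+ k)) → adj G (c (inject₁ i)) (c (suc i)) ≡ true)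
    × adj G (c (fromℕ (2 ℕ+ k))) (c zero) ≡ true

alive : ∀ {n} → List (Fin n) → Fin n → Bool
alive [] v = true
alive (x ∷ ds) v = not ⌊ v ≟ x ⌋ ∧ alive ds v

-- Peel G ds: ds (most recently deleted first) is a sequence of deletions
-- of pendant vertices, each pendant in the graph remaining at that time.
data Peel {n} (G : Graph n) : List (Fin n) → Set where
  done : Peel G []
  del  : ∀ {ds v} → Peel G ds → alive ds v ≡ true →
         degIn G (alive ds) v ≡ 1 → Peel G (v ∷ ds)

NoPendantLeft : ∀ {n} → Graph n → List (Fin n) → Set
NoPendantLeft G ds = ∀ v → alive ds v ≡ true → degIn G (alive ds) v ≢ 1

-- Base of G: the vertex set left by a complete pendant-deletion process.
IsBase : ∀ {n} → Graph n → List (Fin n) → Set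
IsBase G ds = Peel G ds × NoPendantLeft G ds

-- Pendant stars propagate along edges. Suppose every neighbour of x other than p is pendant
-- and d(x) ≥ 2. The identity at a pendant neighbour of x gives d(x) = a + b − 1; writing
-- d(x) = 1 + k, the identities at x and at p then force the excess Σ (d(z) − 1), over the
-- neighbours z ≠ x of p, to equal −b(b + 1)·(k − 1)k ≤ 0, so all those z are pendant too.
-- A connected graph in which both ends of an edge are centres of such stars is a double
-- star, which has no cycle. Hence, when G has a cycle, a vertex all of whose neighbours
-- but one are pendant is itself pendant, so every vertex deleted on the way to the base is
-- pendant in G; (i) follows, since a neighbour of a pendant vertex has degree a + b − 1.
-- For (ii), let the attached vertex u have d base neighbours, with degree sum X. The
-- identity at u yields the formula for X and X − d = −b·(d(u) − 1). Base vertices have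
-- degree ≥ 2, so X ≥ 2d > d (d = 0 would make G a star), whence b < 0.

module Submission where

open import Defs hiding (sym)
open import Data.Nat using (ℕ)
open import Data.Bool using (Bool; true; false; not; _∧_; if_then_else_)
open import Data.Bool.Properties using (not-injective)
open import Data.Fin using (Fin; zero; suc; inject₁; fromℕ; _↑ˡ_)
open import Data.Fin.Properties using (_≟_; ↑ˡ-injective; pigeonhole)
open import Data.List using (List; []; _∷_; map; allFin)
open import Data.List.Membership.Propositional using (_∈_)
open import Data.List.Membership.Propositional.Properties using (∈-allFin)
open import Data.List.Properties using (map-cong)
open import Data.List.Relation.Unary.Unique.Propositional using (Unique)
open import Data.List.Relation.Unary.Unique.Propositional.Properties using (allFin⁺)
open import Data.Nat.ListAction using (sum)
open import Data.Product using (Σ; _×_; ∃-syntax; _,_; proj₁; proj₂)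
open import Data.Sum using (_⊎_; inj₁; inj₂; [_,_])
open import Function using (const)
open import Function.Definitions using (Injective)
open import Relation.Binary.PropositionalEquality using (_≡_; _≢_; refl; sym; trans; cong; cong₂; subst)
open import Relation.Nullary using (¬_; yes; no; contradiction)
open import Relation.Nullary.Decidable using (⌊_⌋)

module _ {A : Set} where
  open import Data.Nat using (ℕ; zero; suc; _+_; _≤_; _<_; z≤n; s≤s)
  open import Data.List.Relation.Unary.All as All using (All; []; _∷_)
  open import Data.List.Relation.Unary.AllPairs using (_∷_)
  open import Data.List.Relation.Unary.Any using (here; there)
  open import Data.Nat.Properties using (+-mono-≤; ≤-trans; m≤m+n; m≤n+m; +-identityʳ; +-commutativeSemigroup)
  open import Algebra.Properties.CommutativeSemigroup +-commutativeSemigroup using (interchange)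

  sum-map-+ : (f g : A → ℕ) (xs : List A) →
              sum (map (λ x → f x + g x) xs) ≡ sum (map f xs) + sum (map g xs)
  sum-map-+ f g []       = refl
  sum-map-+ f g (x ∷ xs) = trans (cong (f x + g x +_) (sum-map-+ f g xs)) (interchange (f x) (g x) _ _)

  sum-map-mono : {f g : A → ℕ} → (∀ x → f x ≤ g x) → (xs : List A) → sum (map f xs) ≤ sum (map g xs)
  sum-map-mono f≤g []       = z≤n
  sum-map-mono f≤g (x ∷ xs) = +-mono-≤ (f≤g x) (sum-map-mono f≤g xs)

  sum-map-≥ : (f : A → ℕ) {x : A} {xs : List A} → x ∈ xs → f x ≤ sum (map f xs)
  sum-map-≥ f {xs = y ∷ ys} (here refl) = m≤m+n (f y) _
  sum-map-≥ f {xs = y ∷ ys} (there x∈) = ≤-trans (sum-map-≥ f x∈) (m≤n+m _ (f y))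

  sum-map-pos : (f : A → ℕ) (xs : List A) → 0 < sum (map f xs) → ∃[ x ] x ∈ xs × 0 < f x
  sum-map-pos f (x ∷ xs) pos with f x in fx≡
  ... | zero  = let y , y∈ , fy>0 = sum-map-pos f xs pos in y , there y∈ , fy>0
  ... | suc _ = x , here refl , subst (0 <_) (sym fx≡) (s≤s z≤n)

  sum-map-zero : (f : A → ℕ) {xs : List A} → All (λ x → f x ≡ 0) xs → sum (map f xs) ≡ 0
  sum-map-zero f []           = refl
  sum-map-zero f (fx≡0 ∷ all) = cong₂ _+_ fx≡0 (sum-map-zero f all)

  sum-map-single : (f : A → ℕ) {x : A} {xs : List A} → Unique xs → x ∈ xs →
                   (∀ y → y ≢ x → f y ≡ 0) → sum (map f xs) ≡ f x
  sum-map-single f (x∉ ∷ _) (here refl) others =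
    trans (cong (f _ +_) (sum-map-zero f (All.map (λ x≢y → others _ (λ y≡x → x≢y (sym y≡x))) x∉)))
          (+-identityʳ _)
  sum-map-single f (y∉ ∷ unique) (there x∈) others =
    cong₂ _+_ (others _ (All.lookup y∉ x∈)) (sum-map-single f unique x∈ others)

module _ {n : ℕ} where
  infixl 7 _∩_ _─_

  _∩_ _─_ : (Fin n → Bool) → (Fin n → Bool) → Fin n → Bool
  (S ∩ T) u = S u ∧ T u
  (S ─ T) u = S u ∧ not (T u)

  ｛_｝ : Fin n → Fin n → Bool
  ｛ q ｝ u = ⌊ u ≟ q ⌋

  ─⁺ : ∀ {S T : Fin n → Bool} {y} → S y ≡ true → T y ≡ false → (S ─ T) y ≡ true
  ─⁺ Sy Ty rewrite Sy | Ty = refl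

  ∩⁺ : ∀ {S T : Fin n → Bool} {y} → S y ≡ true → T y ≡ true → (S ∩ T) y ≡ true
  ∩⁺ Sy Ty rewrite Sy | Ty = refl

  ∩⁻ : ∀ {S T : Fin n → Bool} {y} → (S ∩ T) y ≡ true → S y ≡ true × T y ≡ true
  ∩⁻ {S} {T} {y} S∩Ty with S y | T y
  ... | true | true = refl , refl

  ∈｛｝ : ∀ q → ｛ q ｝ q ≡ true
  ∈｛｝ q with q ≟ q
  ... | yes _   = refl
  ... | no q≢q = contradiction refl q≢q

  ∈｛｝⁻ : ∀ {q y} → ｛ q ｝ y ≡ true → y ≡ q
  ∈｛｝⁻ {q} {y} y∈ with y ≟ q
  ... | yes y≡q = y≡q

  ∉｛｝ : ∀ {q y} → y ≢ q → ｛ q ｝ y ≡ false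
  ∉｛｝ {q} {y} y≢q with y ≟ q
  ... | yes y≡q = contradiction y≡q y≢q
  ... | no _    = refl

  ∉｛｝⁻ : ∀ {q y} → ｛ q ｝ y ≡ false → y ≢ q
  ∉｛｝⁻ {q} y∉ refl = contradiction (trans (sym (∈｛｝ q)) y∉) λ ()

  ─｛｝⁺ : ∀ {q y} → y ≢ q → (allV ─ ｛ q ｝) y ≡ true
  ─｛｝⁺ y≢q = cong not (∉｛｝ y≢q)

  ─｛｝⁻ : ∀ {q y} → (allV ─ ｛ q ｝) y ≡ true → y ≢ q
  ─｛｝⁻ y∈ = ∉｛｝⁻ (not-injective y∈)

module _ {n : ℕ} (G : Graph n) where
  open import Data.Nat using (zero; suc; _+_; _∸_; _≤_; _<_; z≤n)
  open import Data.Nat.Properties using (+-identityʳ; m≤m+n; n≮0; n<1+n; suc-injective; m+[n∸m]≡n)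
  open import Data.Fin.Properties using (<-irrefl)

  adj-sym : ∀ {u v} → adj G u v ≡ true → adj G v u ≡ true
  adj-sym {u} {v} u~v = trans (Graph.sym G v u) u~v

  nbrSum : (Fin n → Bool) → Fin n → (Fin n → ℕ) → ℕ
  nbrSum S v = sumOver (λ u → S u ∧ adj G v u)

  PendantNeighbours : (Fin n → Bool) → Fin n → Set
  PendantNeighbours S v = ∀ y → S y ≡ true → adj G v y ≡ true → deg G y ≡ 1

  PendantOutside : (Fin n → Bool) → Set
  PendantOutside A = ∀ y → A y ≡ false → deg G y ≡ 1

  private
    term : (Fin n → Bool) → Fin n → (Fin n → ℕ) → Fin n → ℕ
    term S v f u = if S u ∧ adj G v u then f u else 0

    term-in : ∀ {S v y} (f : Fin n → ℕ) → S y ≡ true → adj G v y ≡ true → term S v f y ≡ f y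
    term-in f Sy v~y rewrite Sy | v~y = refl

  nbrSum-cong : ∀ {S v} {f g : Fin n → ℕ} →
                (∀ y → S y ≡ true → adj G v y ≡ true → f y ≡ g y) → nbrSum S v f ≡ nbrSum S v g
  nbrSum-cong {S} {v} {f} {g} f≡g = cong sum (map-cong pointwise (allFin n))
    where
    pointwise : ∀ y → term S v f y ≡ term S v g y
    pointwise y with S y in Sy | adj G v y in v~y
    ... | true  | true  = f≡g y Sy v~y
    ... | true  | false = refl
    ... | false | _     = refl

  nbrSum-+ : ∀ {S v} (f g : Fin n → ℕ) → nbrSum S v (λ y → f y + g y) ≡ nbrSum S v f + nbrSum S v g
  nbrSum-+ {S} {v} f g = trans (cong sum (map-cong pointwise (allFin n))) (sum-map-+ _ _ (allFin n))
    where
    pointwise : ∀ y → term S v (λ y → f y + g y) y ≡ term S v f y + term S v g y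
    pointwise y with S y ∧ adj G v y
    ... | true  = refl
    ... | false = refl

  nbrSum-mono : ∀ {S v} {f g : Fin n → ℕ} →
                (∀ y → S y ≡ true → adj G v y ≡ true → f y ≤ g y) → nbrSum S v f ≤ nbrSum S v g
  nbrSum-mono {S} {v} {f} {g} f≤g = sum-map-mono pointwise (allFin n)
    where
    pointwise : ∀ y → term S v f y ≤ term S v g y
    pointwise y with S y in Sy | adj G v y in v~y
    ... | true  | true  = f≤g y Sy v~y
    ... | true  | false = z≤n
    ... | false | _     = z≤n

  nbrSum-≥ : ∀ {S v y} (f : Fin n → ℕ) → S y ≡ true → adj G v y ≡ true → f y ≤ nbrSum S v f
  nbrSum-≥ {S} {v} {y} f Sy v~y =
    subst (_≤ nbrSum S v f) (term-in {S} {v} f Sy v~y) (sum-map-≥ (term S v f) (∈-allFin y))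

  nbrSum-unique : ∀ {S v q} (f : Fin n → ℕ) → S q ≡ true → adj G v q ≡ true →
                  (∀ y → S y ≡ true → adj G v y ≡ true → y ≡ q) → nbrSum S v f ≡ f q
  nbrSum-unique {S} {v} {q} f Sq v~q only-q =
    trans (sum-map-single (term S v f) (allFin⁺ n) (∈-allFin q) others) (term-in {S} {v} f Sq v~q)
    where
    others : ∀ y → y ≢ q → term S v f y ≡ 0
    others y y≢q with S y in Sy | adj G v y in v~y
    ... | true  | true  = contradiction (only-q y Sy v~y) y≢q
    ... | true  | false = refl
    ... | false | _     = refl

  nbrSum-partition : ∀ {S v} (T : Fin n → Bool) (f : Fin n → ℕ) →
                     nbrSum S v f ≡ nbrSum (S ∩ T) v f + nbrSum (S ─ T) v f
  nbrSum-partition {S} {v} T f = trans (cong sum (map-cong pointwise (allFin n))) (sum-map-+ _ _ (allFin n))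
    where
    pointwise : ∀ y → term S v f y ≡ term (S ∩ T) v f y + term (S ─ T) v f y
    pointwise y with S y | T y | adj G v y
    ... | true  | true  | true  = sym (+-identityʳ (f y))
    ... | true  | true  | false = refl
    ... | true  | false | _     = refl
    ... | false | _     | _     = refl

  nbrSum-split-at : ∀ {S v q} (f : Fin n → ℕ) → S q ≡ true → adj G v q ≡ true →
                    nbrSum S v f ≡ f q + nbrSum (S ─ ｛ q ｝) v f
  nbrSum-split-at {S} {v} {q} f Sq v~q =
    trans (nbrSum-partition ｛ q ｝ f) (cong (_+ nbrSum (S ─ ｛ q ｝) v f) only-q)
    where
    only-q : nbrSum (S ∩ ｛ q ｝) v f ≡ f q
    only-q = nbrSum-unique f (∩⁺ {S = S} {T = ｛ q ｝} Sq (∈｛｝ q)) v~q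
                           (λ y y∈ _ → ∈｛｝⁻ (proj₂ (∩⁻ {S = S} {T = ｛ q ｝} y∈)))

  degIn-pos : ∀ {S v} → 0 < degIn G S v → ∃[ y ] S y ≡ true × adj G v y ≡ true
  degIn-pos {S} {v} pos with sum-map-pos (term S v (λ _ → 1)) (allFin n) pos
  ... | y , _ , 0<term with S y in Sy | adj G v y in v~y
  ...   | true  | true  = y , Sy , v~y
  ...   | true  | false = contradiction 0<term n≮0
  ...   | false | _     = contradiction 0<term n≮0

  degIn≡1-unique : ∀ {S v y z} → degIn G S v ≡ 1 → S y ≡ true → adj G v y ≡ true →
                   S z ≡ true → adj G v z ≡ true → z ≡ y
  degIn≡1-unique {S} {v} {y} {z} one Sy v~y Sz v~z with z ≟ y
  ... | yes z≡y = z≡y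
  ... | no z≢y  = contradiction (subst (0 <_) rest≡0 z-in-rest) n≮0
    where
    z-in-rest : 0 < degIn G (S ─ ｛ y ｝) v
    z-in-rest = nbrSum-≥ (λ _ → 1) (─⁺ {S = S} {T = ｛ y ｝} Sz (∉｛｝ z≢y)) v~z
    rest≡0 : degIn G (S ─ ｛ y ｝) v ≡ 0
    rest≡0 = suc-injective (trans (sym (nbrSum-split-at (λ _ → 1) Sy v~y)) one)

  degIn≤deg : ∀ S v → degIn G S v ≤ deg G v
  degIn≤deg S v = subst (degIn G S v ≤_) (sym (nbrSum-partition {allV} S (λ _ → 1))) (m≤m+n _ _)

  deg-pos : ∀ {v y} → adj G v y ≡ true → 0 < deg G y
  deg-pos {v} v~y = nbrSum-≥ {allV} (λ _ → 1) refl (adj-sym v~y)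

  pendant-neighbour-unique : ∀ {w y z} → deg G w ≡ 1 → adj G w y ≡ true → adj G w z ≡ true → z ≡ y
  pendant-neighbour-unique w-pendant w~y w~z = degIn≡1-unique {allV} w-pendant refl w~y refl w~z

  nbrDegSum-pendant : ∀ {w u} → deg G w ≡ 1 → adj G w u ≡ true → nbrDegSum G w ≡ deg G u
  nbrDegSum-pendant w-pendant w~u =
    nbrSum-unique {allV} (deg G) refl w~u (λ y _ w~y → pendant-neighbour-unique w-pendant w~u w~y)

  nbrDegSumIn-excess : ∀ S v → nbrDegSumIn G S v ≡ degIn G S v + nbrSum S v (λ y → deg G y ∸ 1)
  nbrDegSumIn-excess S v =
    trans (nbrSum-cong (λ y _ v~y → sym (m+[n∸m]≡n (deg-pos v~y)))) (nbrSum-+ (λ _ → 1) (λ y → deg G y ∸ 1))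

  two-neighbours-nonpendant : ∀ {v y z} → adj G v y ≡ true → adj G v z ≡ true → z ≢ y → deg G v ≢ 1
  two-neighbours-nonpendant v~y v~z z≢y v-pendant = z≢y (pendant-neighbour-unique v-pendant v~y v~z)

  private
    -- The witness is c₃, or c₀ when the cycle is a triangle.
    successor-of-third : ∀ k (c : Fin (3 + k) → Fin n) → Injective _≡_ _≡_ c →
      (∀ (i : Fin (2 + k)) → adj G (c (inject₁ i)) (c (suc i)) ≡ true) →
      adj G (c (fromℕ (2 + k))) (c zero) ≡ true →
      ∃[ y ] adj G (c (suc (suc zero))) y ≡ true × y ≢ c (suc zero)
    successor-of-third zero    c inj path close = c zero , close , λ eq → contradiction (inj eq) λ ()
    successor-of-third (suc k) c inj path close =
      c (suc (suc (suc zero))) , path (suc (suc zero)) , λ eq → contradiction (inj eq) λ ()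

  cycle-three-nonpendant : HasCycle G →
                           Σ (Fin 3 → Fin n) λ f → Injective _≡_ _≡_ f × (∀ i → deg G (f i) ≢ 1)
  cycle-three-nonpendant (k , c , inj , path , close) =
    (λ i → c (i ↑ˡ k)) , (λ eq → ↑ˡ-injective k _ _ (inj eq)) , nonpendant
    where
    nonpendant : ∀ i → deg G (c (i ↑ˡ k)) ≢ 1
    nonpendant zero =
      two-neighbours-nonpendant (path zero) (adj-sym close) λ eq → contradiction (inj eq) λ ()
    nonpendant (suc zero) =
      two-neighbours-nonpendant (adj-sym (path zero)) (path (suc zero)) λ eq → contradiction (inj eq) λ ()
    nonpendant (suc (suc zero)) =
      let y , c₂~y , y≢c₁ = successor-of-third k c inj path close in
      two-neighbours-nonpendant (adj-sym (path (suc zero))) c₂~y y≢c₁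

  pendant-outside-pair-acyclic : ∀ {x p} → (∀ w → w ≢ x → w ≢ p → deg G w ≡ 1) → ¬ HasCycle G
  pendant-outside-pair-acyclic {x} {p} outside cyc =
    let f , f-inj , nonpendant   = cycle-three-nonpendant cyc
        side-of i                = side (f i) (nonpendant i)
        i , j , i<j , same-index = pigeonhole (n<1+n 2) (λ i → index (side-of i))
    in <-irrefl (f-inj (same-side (side-of i) (side-of j) same-index)) i<j
    where
    side : ∀ w → deg G w ≢ 1 → w ≡ x ⊎ w ≡ p
    side w nonpendant with w ≟ x | w ≟ p
    ... | yes w≡x | _       = inj₁ w≡x
    ... | no _    | yes w≡p = inj₂ w≡p
    ... | no w≢x  | no w≢p  = contradiction (outside w w≢x w≢p) nonpendant
    index : ∀ {w} → w ≡ x ⊎ w ≡ p → Fin 2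
    index = [ const zero , const (suc zero) ]
    same-side : ∀ {w w′} (s : w ≡ x ⊎ w ≡ p) (s′ : w′ ≡ x ⊎ w′ ≡ p) →
                index s ≡ index s′ → w ≡ w′
    same-side (inj₁ refl) (inj₁ refl) _ = refl
    same-side (inj₂ refl) (inj₂ refl) _ = refl

  InDoubleStar : Fin n → Fin n → Fin n → Set
  InDoubleStar x p w = w ≡ x ⊎ w ≡ p ⊎ (deg G w ≡ 1 × (adj G w x ≡ true ⊎ adj G w p ≡ true))

  module _ {x p : Fin n} (x-star : PendantNeighbours (allV ─ ｛ p ｝) x)
                         (p-star : PendantNeighbours (allV ─ ｛ x ｝) p) where

    InDoubleStar-closed : ∀ {u v} → InDoubleStar x p u → adj G u v ≡ true → InDoubleStar x p v
    InDoubleStar-closed {v = v} (inj₁ refl) u~v with v ≟ p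
    ... | yes v≡p = inj₂ (inj₁ v≡p)
    ... | no v≢p  = inj₂ (inj₂ (x-star v (─｛｝⁺ v≢p) u~v , inj₁ (adj-sym u~v)))
    InDoubleStar-closed {v = v} (inj₂ (inj₁ refl)) u~v with v ≟ x
    ... | yes v≡x = inj₁ v≡x
    ... | no v≢x  = inj₂ (inj₂ (p-star v (─｛｝⁺ v≢x) u~v , inj₂ (adj-sym u~v)))
    InDoubleStar-closed (inj₂ (inj₂ (u-pendant , inj₁ u~x))) u~v =
      inj₁ (pendant-neighbour-unique u-pendant u~x u~v)
    InDoubleStar-closed (inj₂ (inj₂ (u-pendant , inj₂ u~p))) u~v =
      inj₂ (inj₁ (pendant-neighbour-unique u-pendant u~p u~v))

    InDoubleStar-reach : ∀ {u v} → Reach G u v → InDoubleStar x p u → InDoubleStar x p v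
    InDoubleStar-reach here           u∈ = u∈
    InDoubleStar-reach (step u~v v⇝w) u∈ = InDoubleStar-reach v⇝w (InDoubleStar-closed u∈ u~v)

    double-star-acyclic : Connected G → ¬ HasCycle G
    double-star-acyclic connected = pendant-outside-pair-acyclic outside
      where
      outside : ∀ w → w ≢ x → w ≢ p → deg G w ≡ 1
      outside w w≢x w≢p with InDoubleStar-reach (connected x w) (inj₁ refl)
      ... | inj₁ w≡x                  = contradiction w≡x w≢x
      ... | inj₂ (inj₁ w≡p)           = contradiction w≡p w≢p
      ... | inj₂ (inj₂ (pendant , _)) = pendant

open import Data.Integer using (ℤ; +_; -_; _+_; _-_; _*_; _≤_; _<_; -1ℤ; 1ℤ)
open import Data.Integer using (-[1+_]; -≤-; +<+)
open import Data.Integer.Properties using (pos-*; +-injective; *-identityʳ)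
open import Data.Integer.Tactic.RingSolver using (solve)
import Data.Nat as ℕ
import Data.Nat.Properties as ℕ
open Relation.Binary.PropositionalEquality.≡-Reasoning

-- At an edge xp where all neighbours of x but p are pendant: d(x) = 1 + k, d(p) = 1 + r, and
-- e = Σ (d(z) − 1) over the neighbours z ≠ x of p. The hypotheses are the identities at a
-- pendant neighbour of x, at x and at p.
star-excess : ∀ a b k r e →
  1ℤ + k ≡ a + b - 1ℤ →
  1ℤ + r + k ≡ a * (1ℤ + k) + b - (1ℤ + k) * (1ℤ + k) →
  1ℤ + k + (r + e) ≡ a * (1ℤ + r) + b - (1ℤ + r) * (1ℤ + r) →
  e ≡ - (b * (b + 1ℤ) * ((k - 1ℤ) * (k - 1ℤ + 1ℤ)))
star-excess a b k r e deg-x sum-x sum-p = begin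
  e
    ≡⟨ solve (k ∷ r ∷ e ∷ []) ⟩
  1ℤ + k + (r + e) - (1ℤ + k) - r
    ≡⟨ cong (λ t → t - (1ℤ + k) - r) sum-p ⟩
  a * (1ℤ + r) + b - (1ℤ + r) * (1ℤ + r) - (1ℤ + k) - r
    ≡⟨ cong₂ (λ a′ r′ → a′ * (1ℤ + r′) + b - (1ℤ + r′) * (1ℤ + r′) - (1ℤ + k) - r′) a≡ r≡ ⟩
  (1ℤ + k + 1ℤ - b) * (1ℤ + - (b * k)) + b - (1ℤ + - (b * k)) * (1ℤ + - (b * k)) - (1ℤ + k) - - (b * k)
    ≡⟨ solve (b ∷ k ∷ []) ⟩
  - (b * (b + 1ℤ) * ((k - 1ℤ) * (k - 1ℤ + 1ℤ)))
    ∎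
  where
  a≡ : a ≡ 1ℤ + k + 1ℤ - b
  a≡ = begin
    a                   ≡⟨ solve (a ∷ b ∷ []) ⟩
    a + b - 1ℤ + 1ℤ - b ≡⟨ cong (λ t → t + 1ℤ - b) deg-x ⟨
    1ℤ + k + 1ℤ - b     ∎
  r≡ : r ≡ - (b * k)
  r≡ = begin
    r                                                                 ≡⟨ solve (r ∷ k ∷ []) ⟩
    1ℤ + r + k - k - 1ℤ                                               ≡⟨ cong (λ t → t - k - 1ℤ) sum-x ⟩
    a * (1ℤ + k) + b - (1ℤ + k) * (1ℤ + k) - k - 1ℤ                   ≡⟨ cong (λ a′ → a′ * (1ℤ + k) + b - (1ℤ + k) * (1ℤ + k) - k - 1ℤ) a≡ ⟩
    (1ℤ + k + 1ℤ - b) * (1ℤ + k) + b - (1ℤ + k) * (1ℤ + k) - k - 1ℤ   ≡⟨ solve (b ∷ k ∷ []) ⟩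
    - (b * k)                                                         ∎

private
  consecutive-product-ℕ : ∀ z → ∃[ m ] z * (z + 1ℤ) ≡ + m
  consecutive-product-ℕ (+ m)    = m ℕ.* (m ℕ.+ 1) , sym (pos-* m (m ℕ.+ 1))
  consecutive-product-ℕ -[1+ m ] = ℕ.suc m ℕ.* m , trans (negate -[1+ m ]) (sym (pos-* (ℕ.suc m) m))
    where
    negate : ∀ z → z * (z + 1ℤ) ≡ - z * (- z - 1ℤ)
    negate z = solve (z ∷ [])

neg-consecutive-products⇒0 : ∀ e x y → + e ≡ - (x * (x + 1ℤ) * (y * (y + 1ℤ))) → e ≡ 0
neg-consecutive-products⇒0 e x y eq with consecutive-product-ℕ x | consecutive-product-ℕ y
... | m , x≡m | m′ , y≡m′ = nonpos (trans eq (cong -_ (trans (cong₂ _*_ x≡m y≡m′) (sym (pos-* m m′)))))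
  where
  nonpos : ∀ {e m} → + e ≡ - + m → e ≡ 0
  nonpos {ℕ.zero}  _  = refl
  nonpos {ℕ.suc _} {ℕ.zero} ()
  nonpos {ℕ.suc _} {ℕ.suc _} ()

-- For a vertex of degree d + c with c pendant neighbours; x is the degree sum of the others.
attached-sum : ∀ a b x d c → x + c ≡ a * (d + c) + b - (d + c) * (d + c) → d + c ≡ a + b - 1ℤ →
               x ≡ - (a * b) - b * b + + 2 * b + d
attached-sum a b x d c sum deg = begin
  x                                                                      ≡⟨ solve (x ∷ c ∷ []) ⟩
  x + c - c                                                              ≡⟨ cong (_- c) sum ⟩
  a * (d + c) + b - (d + c) * (d + c) - c                                ≡⟨ cong₂ (λ s c′ → a * s + b - s * s - c′) deg c≡ ⟩
  a * (a + b - 1ℤ) + b - (a + b - 1ℤ) * (a + b - 1ℤ) - (a + b - 1ℤ - d) ≡⟨ solve (a ∷ b ∷ d ∷ []) ⟩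
  - (a * b) - b * b + + 2 * b + d                                        ∎
  where
  c≡ : c ≡ a + b - 1ℤ - d
  c≡ = begin
    c                 ≡⟨ solve (d ∷ c ∷ []) ⟩
    d + c - d         ≡⟨ cong (_- d) deg ⟩
    a + b - 1ℤ - d    ∎

-- Stated for degree 1 + d + c, so that the factor d + c = degree − 1 is visibly nonnegative.
attached-drop : ∀ a b x d c → 1ℤ + d + c ≡ a + b - 1ℤ → x ≡ - (a * b) - b * b + + 2 * b + (1ℤ + d) →
                x + b * (d + c) ≡ 1ℤ + d
attached-drop a b x d c deg refl = begin
  - (a * b) - b * b + + 2 * b + (1ℤ + d) + b * (d + c)
    ≡⟨ cong (λ a′ → - (a′ * b) - b * b + + 2 * b + (1ℤ + d) + b * (d + c)) a≡ ⟩
  - ((1ℤ + d + c + 1ℤ - b) * b) - b * b + + 2 * b + (1ℤ + d) + b * (d + c)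
    ≡⟨ solve (b ∷ d ∷ c ∷ []) ⟩
  1ℤ + d
    ∎
  where
  a≡ : a ≡ 1ℤ + d + c + 1ℤ - b
  a≡ = begin
    a                     ≡⟨ solve (a ∷ b ∷ []) ⟩
    a + b - 1ℤ + 1ℤ - b   ≡⟨ cong (λ t → t + 1ℤ - b) deg ⟨
    1ℤ + d + c + 1ℤ - b   ∎

negative-coefficient : ∀ b {x y s : ℕ} → y ℕ.< x → + x + b * + s ≡ + y → b ≤ -1ℤ
negative-coefficient -[1+ m ] _ _ = -≤- ℕ.z≤n
negative-coefficient (+ m) {x} {y} {s} y<x eq =
  contradiction (subst (x ℕ.≤_) x+ms≡y (ℕ.m≤m+n x (m ℕ.* s))) (ℕ.<⇒≱ y<x)
  where
  x+ms≡y : x ℕ.+ m ℕ.* s ≡ y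
  x+ms≡y = +-injective (trans (cong (λ t → + x + t) (pos-* m s)) eq)

module _ {n : ℕ} {G : Graph n} {a b : ℤ} (sat : Satisfies G a b) where

  identity-at : ∀ v {d s} → deg G v ≡ d → nbrDegSum G v ≡ s → + s ≡ a * + d + b - + d * + d
  identity-at v refl refl = sat v

  pendant-neighbour-degree : ∀ {w u} → deg G w ≡ 1 → adj G w u ≡ true → + (deg G u) ≡ a + b - 1ℤ
  pendant-neighbour-degree w-pendant w~u =
    trans (identity-at _ w-pendant (nbrDegSum-pendant G w-pendant w~u))
          (cong (λ t → t + b - 1ℤ) (*-identityʳ a))

  pendant-star-propagates : ∀ {x p} → adj G x p ≡ true → 1 ℕ.< deg G x →
    PendantNeighbours G (allV ─ ｛ p ｝) x → PendantNeighbours G (allV ─ ｛ x ｝) p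
  pendant-star-propagates {x} {p} x~p 1<deg-x x-star z z≢x p~z =
    ℕ.≤-antisym (ℕ.m∸n≡0⇒m≤n excess-z≡0) (deg-pos G p~z)
    where
    k r e : ℕ
    k = degIn G (allV ─ ｛ p ｝) x
    r = degIn G (allV ─ ｛ x ｝) p
    e = nbrSum G (allV ─ ｛ x ｝) p (λ y → deg G y ℕ.∸ 1)
    deg-x : deg G x ≡ ℕ.suc k
    deg-x = nbrSum-split-at G (λ _ → 1) refl x~p
    deg-p : deg G p ≡ ℕ.suc r
    deg-p = nbrSum-split-at G (λ _ → 1) refl (adj-sym G x~p)
    sum-x : nbrDegSum G x ≡ ℕ.suc r ℕ.+ k
    sum-x = trans (nbrSum-split-at G (deg G) refl x~p) (cong₂ ℕ._+_ deg-p (nbrSum-cong G x-star))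
    sum-p : nbrDegSum G p ≡ ℕ.suc k ℕ.+ (r ℕ.+ e)
    sum-p = trans (nbrSum-split-at G (deg G) refl (adj-sym G x~p))
                  (cong₂ ℕ._+_ deg-x (nbrDegSumIn-excess G _ p))
    x-attached : + (deg G x) ≡ a + b - 1ℤ
    x-attached =
      let y , y≢p , x~y = degIn-pos G (ℕ.s≤s⁻¹ (subst (1 ℕ.<_) deg-x 1<deg-x))
      in pendant-neighbour-degree (x-star y y≢p x~y) (adj-sym G x~y)
    e≡0 : e ≡ 0
    e≡0 = neg-consecutive-products⇒0 e b (+ k - 1ℤ)
      (star-excess a b (+ k) (+ r) (+ e) (trans (cong +_ (sym deg-x)) x-attached)
                   (identity-at x deg-x sum-x) (identity-at p deg-p sum-p))
    excess-z≡0 : deg G z ℕ.∸ 1 ≡ 0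
    excess-z≡0 = ℕ.n≤0⇒n≡0 (subst (deg G z ℕ.∸ 1 ℕ.≤_) e≡0
                                   (nbrSum-≥ G (λ y → deg G y ℕ.∸ 1) z≢x p~z))

  degree-in-base : ∀ {A} → PendantOutside G A → ∀ u →
                   (+ (deg G u) ≡ + (degIn G A u)) ⊎ (+ (deg G u) ≡ a + b - 1ℤ)
  degree-in-base {A} outside u
    with degIn G (allV ─ A) u in outside-count | nbrSum-partition G {allV} {u} A (λ _ → 1)
  ... | ℕ.zero  | deg≡ = inj₁ (cong +_ (trans deg≡ (ℕ.+-identityʳ _)))
  ... | ℕ.suc _ | _    =
    let y , Ay≡false , u~y = degIn-pos G (subst (0 ℕ.<_) (sym outside-count) (ℕ.s≤s ℕ.z≤n))
    in inj₂ (pendant-neighbour-degree (outside y (not-injective Ay≡false)) (adj-sym G u~y))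

  module _ (connected : Connected G) (cyclic : HasCycle G) where

    pendant-if-one-neighbour-inside : ∀ {A v} → PendantOutside G A → degIn G A v ≡ 1 → deg G v ≡ 1
    pendant-if-one-neighbour-inside {A} {v} outside one = by-degree (deg G v) refl
      where
      inside = degIn-pos G (subst (0 ℕ.<_) (sym one) (ℕ.s≤s ℕ.z≤n))
      p = proj₁ inside
      v~p = proj₂ (proj₂ inside)
      v-star : PendantNeighbours G (allV ─ ｛ p ｝) v
      v-star y y≢p v~y with A y in Ay
      ... | true  = contradiction (degIn≡1-unique G one (proj₁ (proj₂ inside)) v~p Ay v~y) (─｛｝⁻ y≢p)
      ... | false = outside y Ay
      by-degree : ∀ d → deg G v ≡ d → deg G v ≡ 1
      by-degree ℕ.zero            deg≡ = contradiction (subst (0 ℕ.<_) deg≡ (deg-pos G (adj-sym G v~p))) λ ()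
      by-degree (ℕ.suc ℕ.zero)    deg≡ = deg≡
      by-degree (ℕ.suc (ℕ.suc _)) deg≡ =
        let 1<deg = subst (1 ℕ.<_) (sym deg≡) (ℕ.s≤s (ℕ.s≤s ℕ.z≤n))
        in contradiction cyclic
             (double-star-acyclic G v-star (pendant-star-propagates v~p 1<deg v-star) connected)

    peeled-pendant : ∀ {ds} → Peel G ds → PendantOutside G (alive ds)
    peeled-pendant done                      u ()
    peeled-pendant (del {ds} {v} peel _ one) u dead with u ≟ v
    ... | yes refl = pendant-if-one-neighbour-inside (peeled-pendant peel) one
    ... | no _     = peeled-pendant peel u dead

    module _ {A} (outside : PendantOutside G A) (no-pendant-left : ∀ v → A v ≡ true → degIn G A v ≢ 1) where

      pendant-neighbour-outside : ∀ {u w} → A u ≡ true → adj G u w ≡ true → deg G w ≡ 1 → A w ≡ false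
      pendant-neighbour-outside {u} {w} Au u~w w-pendant with A w in Aw
      ... | false = refl
      ... | true  = contradiction (ℕ.≤-antisym (subst (degIn G A w ℕ.≤_) w-pendant (degIn≤deg G A w)) inside)
                                  (no-pendant-left w Aw)
        where
        inside : 1 ℕ.≤ degIn G A w
        inside = nbrSum-≥ G (λ _ → 1) Au (adj-sym G u~w)

      base-neighbour-degree : ∀ {u y} → A u ≡ true → A y ≡ true → adj G u y ≡ true → 2 ℕ.≤ deg G y
      base-neighbour-degree {u} {y} Au Ay u~y =
        ℕ.≤-trans (ℕ.≤∧≢⇒< inside (λ 1≡ → no-pendant-left y Ay (sym 1≡))) (degIn≤deg G A y)
        where
        inside : 1 ℕ.≤ degIn G A y
        inside = nbrSum-≥ G (λ _ → 1) Au (adj-sym G u~y)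

      base-nbrDegSum-≥ : ∀ {u} → A u ≡ true → degIn G A u ℕ.+ degIn G A u ℕ.≤ nbrDegSumIn G A u
      base-nbrDegSum-≥ {u} Au =
        subst (ℕ._≤ nbrDegSumIn G A u) (nbrSum-+ G (λ _ → 1) (λ _ → 1))
              (nbrSum-mono G (λ y Ay u~y → base-neighbour-degree Au Ay u~y))

      nbrDegSum-split : ∀ u → nbrDegSum G u ≡ nbrDegSumIn G A u ℕ.+ degIn G (allV ─ A) u
      nbrDegSum-split u =
        trans (nbrSum-partition G A (deg G))
              (cong (nbrDegSumIn G A u ℕ.+_) (nbrSum-cong G (λ y y∉A _ → outside y (not-injective y∉A))))

      b-negative : ∀ {u} → A u ≡ true → + (deg G u) ≡ a + b - 1ℤ →
                   + (nbrDegSumIn G A u) ≡ - (a * b) - b * b + + 2 * b + + (degIn G A u) → b ≤ -1ℤ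
      b-negative {u} Au deg-u sum-formula = by-base-degree (degIn G A u) refl
        where
        c = degIn G (allV ─ A) u
        X = nbrDegSumIn G A u
        by-base-degree : ∀ d → degIn G A u ≡ d → b ≤ -1ℤ
        by-base-degree ℕ.zero no-inside = contradiction cyclic (double-star-acyclic G u-star u-star connected)
          where
          -- G would be a star centred at u.
          u-star : PendantNeighbours G (allV ─ ｛ u ｝) u
          u-star y _ u~y with A y in Ay
          ... | true  = contradiction (subst (1 ℕ.≤_) no-inside (nbrSum-≥ G (λ _ → 1) Ay u~y)) λ ()
          ... | false = outside y Ay
        by-base-degree (ℕ.suc d′) d≡ = negative-coefficient b d<X (trans drop (cong +_ (sym d≡)))
          where
          drop : + X + b * (+ d′ + + c) ≡ 1ℤ + + d′
          drop = attached-drop a b (+ X) (+ d′) (+ c)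
            (trans (cong (λ m → + (m ℕ.+ c)) (sym d≡))
                   (trans (cong +_ (sym (nbrSum-partition G A (λ _ → 1)))) deg-u))
            (subst (λ m → + X ≡ - (a * b) - b * b + + 2 * b + + m) d≡ sum-formula)
          d<X : degIn G A u ℕ.< X
          d<X = ℕ.<-≤-trans (ℕ.m<m+n (degIn G A u) (subst (0 ℕ.<_) (sym d≡) (ℕ.s≤s ℕ.z≤n)))
                            (base-nbrDegSum-≥ Au)

      attached-vertex : ∀ {u w} → A u ≡ true → adj G u w ≡ true → deg G w ≡ 1 →
           b ≤ -1ℤ
           × + (deg G u) ≡ a + b - 1ℤ
           × + (degIn G A u) < + (deg G u)
           × + (nbrDegSumIn G A u) ≡ - (a * b) - b * b + + 2 * b + + (degIn G A u)
      attached-vertex {u} {w} Au u~w w-pendant =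
        b-negative Au deg-u sum-formula , deg-u , +<+ inside<deg , sum-formula
        where
        deg≡ : deg G u ≡ degIn G A u ℕ.+ degIn G (allV ─ A) u
        deg≡ = nbrSum-partition G A (λ _ → 1)
        deg-u : + (deg G u) ≡ a + b - 1ℤ
        deg-u = pendant-neighbour-degree w-pendant (adj-sym G u~w)
        inside<deg : degIn G A u ℕ.< deg G u
        inside<deg = subst (degIn G A u ℕ.<_) (sym deg≡) (ℕ.m<m+n (degIn G A u) w-outside)
          where
          w-outside : 1 ℕ.≤ degIn G (allV ─ A) u
          w-outside = nbrSum-≥ G (λ _ → 1) (cong not (pendant-neighbour-outside Au u~w w-pendant)) u~w
        sum-formula : + (nbrDegSumIn G A u) ≡ - (a * b) - b * b + + 2 * b + + (degIn G A u)
        sum-formula = attached-sum a b (+ nbrDegSumIn G A u) (+ degIn G A u) (+ degIn G (allV ─ A) u)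
          (identity-at u deg≡ (nbrDegSum-split u)) (trans (cong +_ (sym deg≡)) deg-u)

lemma1p8 : ∀ {n} (G : Graph n) (a b : ℤ) → InClass G a b → Connected G → HasEdge G →
    HasCycle G → (Σ (Fin n) λ w → deg G w ≡ 1) →
    (ds : List (Fin n)) → IsBase G ds →
    (∀ u → (alive ds u ≡ true →
              (+ (deg G u) ≡ + (degIn G (alive ds) u)) ⊎ (+ (deg G u) ≡ a + b - 1ℤ))
         × (alive ds u ≡ false → deg G u ≡ 1))
    × (∀ u → alive ds u ≡ true → (Σ (Fin n) λ w → adj G u w ≡ true × deg G w ≡ 1) →
         b ≤ -1ℤ
         × + (deg G u) ≡ a + b - 1ℤ
         × + (degIn G (alive ds) u) < + (deg G u)
         × + (nbrDegSumIn G (alive ds) u) ≡ - (a * b) - b * b + + 2 * b + + (degIn G (alive ds) u))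
lemma1p8 G a b (sat , _) connected _ cyclic _ ds (peel , no-pendant-left) =
  (λ u → (λ _ → degree-in-base {G = G} {a} {b} sat outside u) , outside u) ,
  (λ u Au (w , u~w , w-pendant) →
     attached-vertex {G = G} {a} {b} sat connected cyclic outside no-pendant-left Au u~w w-pendant)
  where
  outside : PendantOutside G (alive ds)
  outside = peeled-pendant {G = G} {a} {b} sat connected cyclic peel
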